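{- Let $s$ and $t$ be $\mathcal L$-terms. Then either (1) $\Sigma$ entails the identity $s=t$, or (2) $\Sigma\cup\{s=t\}$ entails the identity $x=y$ (with $x,y$ distinct variables).
   Context: $\mathcal L$ is the language with one binary operation symbol $\cdot$ and two unary operation symbols $\ell$ and $r$. $\Sigma$ is the set of identities $\ell(x\cdot y)=x$, $r(x\cdot y)=y$, $\ell(z)\cdot r(z)=z$ (the axioms of Jónsson–Tarski algebras). -}

module Defs where

open import Data.Nat using (ℕ)
open import Data.Product using (_×_; _,_)
open import Data.Sum using (_⊎_)
open import Relation.Binary.PropositionalEquality using (_≡_)

data Term : Set where
  var : ℕ → Term
  _·_ : Term → Term → Term
  ℓ   : Term → Term
  r   : Term → Term

Identity : Set
Identity = Term × Term

record LAlgebra : Set₁ where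
  field
    Carrier : Set
    _∙_     : Carrier → Carrier → Carrier
    lop     : Carrier → Carrier
    rop     : Carrier → Carrier

open LAlgebra public

⟦_⟧ : Term → (A : LAlgebra) → (ℕ → Carrier A) → Carrier A
⟦ var n ⟧ A ρ = ρ n
⟦ u · v ⟧ A ρ = _∙_ A (⟦ u ⟧ A ρ) (⟦ v ⟧ A ρ)
⟦ ℓ u ⟧ A ρ = lop A (⟦ u ⟧ A ρ)
⟦ r u ⟧ A ρ = rop A (⟦ u ⟧ A ρ)

_⊨_ : LAlgebra → Identity → Set
A ⊨ (u , v) = (ρ : ℕ → Carrier A) → ⟦ u ⟧ A ρ ≡ ⟦ v ⟧ A ρ

IdSet : Set₁
IdSet = Identity → Set

_⊢_ : IdSet → Identity → Set₁
E ⊢ e = (A : LAlgebra) → ((d : Identity) → E d → A ⊨ d) → A ⊨ e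

-- Σ: the Jónsson–Tarski axioms, with variables x = var 0, y = var 1, z = var 2
data Σ-JT : IdSet where
  ax-ℓ : Σ-JT (ℓ (var 0 · var 1) , var 0)
  ax-r : Σ-JT (r (var 0 · var 1) , var 1)
  ax-lr : Σ-JT (ℓ (var 2) · r (var 2) , var 2)

_∪⟨_⟩ : IdSet → Identity → IdSet
(E ∪⟨ e ⟩) d = E d ⊎ d ≡ e

module Submission where

-- Modulo the Jónsson–Tarski axioms every term is equal to a
-- normal form: a binary tree of pairings whose leaves are "paths" w(x),
-- i.e. a word w in ℓ, r applied to a variable x (ℓ and r are pushed
-- through pairings by the axioms ℓ(x·y)=x, r(x·y)=y).  Two normal forms are
-- compared by structural recursion; a leaf facing a pairing is first
-- expanded with z = ℓ(z)·r(z).  Eventually two leaves w(x), w'(y) meet, and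
-- either they coincide, or the equation w(x) = w'(y) forces every
-- JT-algebra satisfying it to be trivial: for x ≠ y because every path is
-- surjective, for x = y and w ≠ w' by a short analysis of the two words.
-- Triviality propagates through pairings since · is injective.  So any two
-- normal forms are either equal in all JT-algebras or collapse every
-- JT-algebra in which they are equal; applied to the normal forms of s and
-- t this is exactly the dichotomy of the theorem.

open import Defs hiding (Carrier; _∙_; lop; rop)
open import Data.Bool using (Bool; true; false; not)
import Data.Bool.Properties as Bool
open import Data.List using (List; []; _∷_; _++_; [_])
open import Data.List.Properties using (≡-dec)
open import Data.Nat using (ℕ; _≟_)
open import Data.Product using (_,_)
open import Data.Sum using (_⊎_; inj₁; inj₂)
open import Function using (id)
open import Relation.Nullary using (yes; no; contradiction)
open import Relation.Binary.PropositionalEquality hiding ([_])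

-- The Jónsson–Tarski laws for an L-algebra: · is a bijection A × A → A
-- with inverse (ℓ, r).
record IsJT (A : LAlgebra) : Set where
  open LAlgebra A
  field
    ℓ-∙ : ∀ a b → lop (a ∙ b) ≡ a
    r-∙ : ∀ a b → rop (a ∙ b) ≡ b
    ℓ∙r : ∀ c → lop c ∙ rop c ≡ c

Trivial : LAlgebra → Set
Trivial A = (c d : LAlgebra.Carrier A) → c ≡ d

-- A path is a word in ℓ (false) and r (true); its head is applied first.
Path : Set
Path = List Bool

data NF : Set where
  leaf : Path → ℕ → NF
  node : NF → NF → NF

twoPoint : {X : Set} → ℕ → X → X → ℕ → X
twoPoint x p q z with x ≟ z
... | yes _ = p
... | no _  = q

twoPoint-at : {X : Set} (x : ℕ) (p q : X) → twoPoint x p q x ≡ p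
twoPoint-at x p q with x ≟ x
... | yes _  = refl
... | no x≢x = contradiction refl x≢x

twoPoint-off : {X : Set} (x z : ℕ) (p q : X) → x ≢ z → twoPoint x p q z ≡ q
twoPoint-off x z p q x≢z with x ≟ z
... | yes x≡z = contradiction x≡z x≢z
... | no _    = refl

module Operations (A : LAlgebra) where
  open LAlgebra A

  step : Bool → Carrier → Carrier
  step false = lop
  step true  = rop

  run : Path → Carrier → Carrier
  run []      a = a
  run (b ∷ w) a = run w (step b a)

  ⟦_⟧ₙ : NF → (ℕ → Carrier) → Carrier
  ⟦ leaf w x ⟧ₙ ρ = run w (ρ x)
  ⟦ node p q ⟧ₙ ρ = ⟦ p ⟧ₙ ρ ∙ ⟦ q ⟧ₙ ρ

  run-snoc : ∀ w b a → run (w ++ [ b ]) a ≡ step b (run w a)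
  run-snoc []      b a = refl
  run-snoc (c ∷ w) b a = run-snoc w b (step c a)

module Laws {A : LAlgebra} (J : IsJT A) where
  open LAlgebra A
  open IsJT J
  open Operations A

  ∙-cancelˡ : ∀ {a b a' b'} → a ∙ b ≡ a' ∙ b' → a ≡ a'
  ∙-cancelˡ {a} {b} {a'} {b'} e = trans (sym (ℓ-∙ a b)) (trans (cong lop e) (ℓ-∙ a' b'))

  ∙-cancelʳ : ∀ {a b a' b'} → a ∙ b ≡ a' ∙ b' → b ≡ b'
  ∙-cancelʳ {a} {b} {a'} {b'} e = trans (sym (r-∙ a b)) (trans (cong rop e) (r-∙ a' b'))

  step-diag : ∀ b c → step b (c ∙ c) ≡ c
  step-diag false c = ℓ-∙ c c
  step-diag true  c = r-∙ c c

  -- Every path is surjective: section w c is a preimage of c under run w.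
  section : Path → Carrier → Carrier
  section []      c = c
  section (b ∷ w) c = section w c ∙ section w c

  run-section : ∀ w c → run w (section w c) ≡ c
  run-section []      c = refl
  run-section (b ∷ w) c =
    trans (cong (run w) (step-diag b (section w c))) (run-section w c)

  pairAt : Bool → Carrier → Carrier → Carrier
  pairAt false c d = c ∙ d
  pairAt true  c d = d ∙ c

  step-pairAt : ∀ b c d → step b (pairAt b c d) ≡ c
  step-pairAt false c d = ℓ-∙ c d
  step-pairAt true  c d = r-∙ d c

  step-not-pairAt : ∀ b c d → step (not b) (pairAt b c d) ≡ d
  step-not-pairAt false c d = r-∙ c d
  step-not-pairAt true  c d = ℓ-∙ d c

  -- Since each step is surjective, a common first step can be cancelled.
  cancel-head : ∀ b v v' → run (b ∷ v) ≗ run (b ∷ v') → run v ≗ run v'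
  cancel-head b v v' h c = begin
    run v c                   ≡⟨ cong (run v) (step-diag b c) ⟨
    run (b ∷ v) (c ∙ c)       ≡⟨ h (c ∙ c) ⟩
    run (b ∷ v') (c ∙ c)      ≡⟨ cong (run v') (step-diag b c) ⟩
    run v' c                  ∎
    where open ≡-Reasoning

  -- A nonempty path acting as the identity collapses the algebra:
  -- pairAt b c d and pairAt b c c have the same b-component, hence are equal.
  identity-path⇒trivial : ∀ b v → run (b ∷ v) ≗ id → Trivial A
  identity-path⇒trivial b v h c d = sym (begin
    d                                ≡⟨ step-not-pairAt b c d ⟨
    step (not b) (pairAt b c d)      ≡⟨ cong (step (not b)) same-pair ⟩
    step (not b) (pairAt b c c)      ≡⟨ step-not-pairAt b c c ⟩
    c                                ∎)
    where
    open ≡-Reasoning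
    through-b : ∀ e → pairAt b c e ≡ run v c
    through-b e =
      trans (sym (h (pairAt b c e))) (cong (run v) (step-pairAt b c e))
    same-pair : pairAt b c d ≡ pairAt b c c
    same-pair = trans (through-b d) (sym (through-b c))

  -- Paths starting in opposite directions act independently, so if they
  -- agree everywhere the algebra is trivial.
  divergent⇒trivial : ∀ b v v' → run (b ∷ v) ≗ run (not b ∷ v') → Trivial A
  divergent⇒trivial b v v' h c d = begin
    c                                  ≡⟨ run-section v c ⟨
    run v (section v c)                ≡⟨ cong (run v) (step-pairAt b _ _) ⟨
    run (b ∷ v) p                      ≡⟨ h p ⟩
    run (not b ∷ v') p                 ≡⟨ cong (run v') (step-not-pairAt b _ _) ⟩
    run v' (section v' d)              ≡⟨ run-section v' d ⟩
    d                                  ∎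
    where
    open ≡-Reasoning
    p = pairAt b (section v c) (section v' d)

  distinct-paths⇒trivial : ∀ w w' → w ≢ w' → run w ≗ run w' → Trivial A
  distinct-paths⇒trivial []      []      w≢w' _ = contradiction refl w≢w'
  distinct-paths⇒trivial []      (b ∷ v) _ h = identity-path⇒trivial b v (λ a → sym (h a))
  distinct-paths⇒trivial (b ∷ v) []      _ h = identity-path⇒trivial b v h
  distinct-paths⇒trivial (false ∷ v) (true ∷ v')  _ h = divergent⇒trivial false v v' h
  distinct-paths⇒trivial (true ∷ v)  (false ∷ v') _ h = divergent⇒trivial true v v' h
  distinct-paths⇒trivial (false ∷ v) (false ∷ v') w≢w' h =
    distinct-paths⇒trivial v v' (λ v≡v' → w≢w' (cong (false ∷_) v≡v')) (cancel-head false v v' h)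
  distinct-paths⇒trivial (true ∷ v)  (true ∷ v')  w≢w' h =
    distinct-paths⇒trivial v v' (λ v≡v' → w≢w' (cong (true ∷_) v≡v')) (cancel-head true v v' h)

  -- Paths applied to distinct variables can be given arbitrary values c, d
  -- (assign the variables sections of c and d), so equating them collapses
  -- the algebra.
  distinct-variables⇒trivial : ∀ w w' {x y} → x ≢ y →
    (∀ ρ → run w (ρ x) ≡ run w' (ρ y)) → Trivial A
  distinct-variables⇒trivial w w' {x} {y} x≢y h c d = begin
    c                       ≡⟨ run-section w c ⟨
    run w (section w c)     ≡⟨ cong (run w) (twoPoint-at x _ _) ⟨
    run w (ρ x)             ≡⟨ h ρ ⟩
    run w' (ρ y)            ≡⟨ cong (run w') (twoPoint-off x y _ _ x≢y) ⟩
    run w' (section w' d)   ≡⟨ run-section w' d ⟩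
    d                       ∎
    where
    open ≡-Reasoning
    ρ = twoPoint x (section w c) (section w' d)

_≈JT_ : NF → NF → Set₁
p ≈JT q = (A : LAlgebra) → IsJT A → Operations.⟦_⟧ₙ A p ≗ Operations.⟦_⟧ₙ A q

Collapses : NF → NF → Set₁
Collapses p q = (A : LAlgebra) → IsJT A → Operations.⟦_⟧ₙ A p ≗ Operations.⟦_⟧ₙ A q → Trivial A

data Dichotomy (p q : NF) : Set₁ where
  equal    : p ≈JT q      → Dichotomy p q
  collapse : Collapses p q → Dichotomy p q

private
  variable
    p q p' q' : NF

dichotomy-sym : Dichotomy p q → Dichotomy q p
dichotomy-sym (equal e)    = equal λ A J ρ → sym (e A J ρ)
dichotomy-sym (collapse c) = collapse λ A J h → c A J (λ ρ → sym (h ρ))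

dichotomy-transˡ : p ≈JT p' → Dichotomy p' q → Dichotomy p q
dichotomy-transˡ e (equal e')   = equal λ A J ρ → trans (e A J ρ) (e' A J ρ)
dichotomy-transˡ e (collapse c) = collapse λ A J h → c A J (λ ρ → trans (sym (e A J ρ)) (h ρ))

-- Pairing is injective, so the dichotomy passes to pairs componentwise.
dichotomy-node : Dichotomy p p' → Dichotomy q q' → Dichotomy (node p q) (node p' q')
dichotomy-node (collapse c) _ =
  collapse λ A J h → c A J (λ ρ → Laws.∙-cancelˡ J (h ρ))
dichotomy-node (equal _) (collapse c) =
  collapse λ A J h → c A J (λ ρ → Laws.∙-cancelʳ J (h ρ))
dichotomy-node (equal e) (equal e') =
  equal λ A J ρ → cong₂ (LAlgebra._∙_ A) (e A J ρ) (e' A J ρ)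

leaf-dichotomy : ∀ w x w' y → Dichotomy (leaf w x) (leaf w' y)
leaf-dichotomy w x w' y with x ≟ y
... | no x≢y = collapse λ A J h → Laws.distinct-variables⇒trivial J w w' x≢y h
... | yes refl with ≡-dec Bool._≟_ w w'
...   | yes refl = equal λ _ _ _ → refl
...   | no w≢w'  = collapse λ A J h → Laws.distinct-paths⇒trivial J w w' w≢w' (λ a → h (λ _ → a))

-- z = ℓ(z)·r(z) applied to a leaf.
leaf-expand : ∀ w x → leaf w x ≈JT node (leaf (w ++ [ false ]) x) (leaf (w ++ [ true ]) x)
leaf-expand w x A J ρ = sym (begin
  run (w ++ [ false ]) a ∙ run (w ++ [ true ]) a
    ≡⟨ cong₂ _∙_ (run-snoc w false a) (run-snoc w true a) ⟩
  lop (run w a) ∙ rop (run w a)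
    ≡⟨ IsJT.ℓ∙r J (run w a) ⟩
  run w a ∎)
  where
  open ≡-Reasoning
  open LAlgebra A
  open Operations A
  a = ρ x

compare-leaf : ∀ w x q → Dichotomy (leaf w x) q
compare-leaf w x (leaf w' y) = leaf-dichotomy w x w' y
compare-leaf w x (node q q') =
  dichotomy-transˡ (leaf-expand w x)
    (dichotomy-node (compare-leaf (w ++ [ false ]) x q) (compare-leaf (w ++ [ true ]) x q'))

compare : ∀ p q → Dichotomy p q
compare (leaf w x) q           = compare-leaf w x q
compare (node p q) (leaf w x)  = dichotomy-sym (compare-leaf w x (node p q))
compare (node p q) (node p' q') = dichotomy-node (compare p p') (compare q q')

nf-step : Bool → NF → NF
nf-step b     (leaf w x) = leaf (w ++ [ b ]) x
nf-step false (node p q) = p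
nf-step true  (node p q) = q

nf : Term → NF
nf (var x) = leaf [] x
nf (u · v) = node (nf u) (nf v)
nf (ℓ u)   = nf-step false (nf u)
nf (r u)   = nf-step true (nf u)

module Normalisation {A : LAlgebra} (J : IsJT A) where
  open LAlgebra A
  open IsJT J
  open Operations A

  step-nf-step : ∀ b p ρ → step b (⟦ p ⟧ₙ ρ) ≡ ⟦ nf-step b p ⟧ₙ ρ
  step-nf-step b     (leaf w x) ρ = sym (run-snoc w b (ρ x))
  step-nf-step false (node p q) ρ = ℓ-∙ _ _
  step-nf-step true  (node p q) ρ = r-∙ _ _

  nf-sound : ∀ u ρ → ⟦ u ⟧ A ρ ≡ ⟦ nf u ⟧ₙ ρ
  nf-sound (var x) ρ = refl
  nf-sound (u · v) ρ = cong₂ _∙_ (nf-sound u ρ) (nf-sound v ρ)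
  nf-sound (ℓ u)   ρ = trans (cong lop (nf-sound u ρ)) (step-nf-step false (nf u) ρ)
  nf-sound (r u)   ρ = trans (cong rop (nf-sound u ρ)) (step-nf-step true (nf u) ρ)

  ⊨⇒nf≗ : ∀ s t → A ⊨ (s , t) → ⟦ nf s ⟧ₙ ≗ ⟦ nf t ⟧ₙ
  ⊨⇒nf≗ s t h ρ = trans (sym (nf-sound s ρ)) (trans (h ρ) (nf-sound t ρ))

  nf≗⇒⊨ : ∀ s t → ⟦ nf s ⟧ₙ ≗ ⟦ nf t ⟧ₙ → A ⊨ (s , t)
  nf≗⇒⊨ s t h ρ = trans (nf-sound s ρ) (trans (h ρ) (sym (nf-sound t ρ)))

Σ-model⇒IsJT : {A : LAlgebra} → ((d : Identity) → Σ-JT d → A ⊨ d) → IsJT A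
Σ-model⇒IsJT h = record
  { ℓ-∙ = λ a b → h _ ax-ℓ (twoPoint 0 a b)
  ; r-∙ = λ a b → h _ ax-r (twoPoint 0 a b)
  ; ℓ∙r = λ c → h _ ax-lr (λ _ → c)
  }

lemma3p2 : (s t : Term) →
    (Σ-JT ⊢ (s , t)) ⊎
    ((x y : ℕ) → x ≢ y → (Σ-JT ∪⟨ (s , t) ⟩) ⊢ (var x , var y))
lemma3p2 s t with compare (nf s) (nf t)
... | equal s≈t = inj₁ λ A ⊨Σ →
  let J = Σ-model⇒IsJT ⊨Σ
  in Normalisation.nf≗⇒⊨ J s t (s≈t A J)
... | collapse s↯t = inj₂ λ x y _ A ⊨Σ+st ρ →
  let J = Σ-model⇒IsJT (λ d d∈Σ → ⊨Σ+st d (inj₁ d∈Σ))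
      nf-eq = Normalisation.⊨⇒nf≗ J s t (⊨Σ+st (s , t) (inj₂ refl))
  in s↯t A J nf-eq (ρ x) (ρ y)
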